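{- Let $p$ be a prime, $n\ge1$ an integer and $b=p^n$, and write $\vartheta(p^n)=\sum_{i\ge1}d_ib^{ -i}$ with digits $0\le d_i<b$ not eventually all $0$. Then either the expansion is purely periodic, i.e. there is $s\ge1$ with $d_{i+s}=d_i$ for all $i\ge1$ ($\vartheta(p^n)=\{0.\overline{d_1\cdots d_s}\}_b$), or it is mixed periodic with exactly one non-periodic digit, i.e. there is $s\ge1$ with $d_{i+s}=d_i$ for all $i\ge2$ and $d_{s+1}\ne d_1$ ($\vartheta(p^n)=\{0.d_1\overline{d_2\cdots d_{s+1}}\}_b$).
   Context: $Z_b(m)$ is the number of trailing zeroes in the base-$b$ expansion of $m!$. $\vartheta(b):=\lim_{m\to\infty}Z_b(m)/m$; in particular $\vartheta(p^n)=\frac{1}{n(p-1)}$. -}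

module Defs where

open import Data.Nat using (ℕ; zero; suc; _+_; _*_; _∸_; _^_; _≤_; _<_)
open import Data.Product using (_×_)

-- ϑ(p^n) = 1 / (n (p - 1)), as given in the context; we represent this
-- rational by its denominator (numerator is 1).
ϑ-den : ℕ → ℕ → ℕ
ϑ-den p n = n * (p ∸ 1)

-- partialNum b d k = Σ_{i=1}^{k} d_i b^{k-i}  (so Σ_{i=1}^k d_i b^{-i} = partialNum b d k / b^k).
-- Digits are indexed from 1; d 0 is ignored.
partialNum : ℕ → (ℕ → ℕ) → ℕ → ℕ
partialNum b d zero    = 0
partialNum b d (suc k) = partialNum b d k * b + d (suc k)

-- d is the base-b expansion of num/den whose digits are not eventually all 0:
-- for every k, S_k < num/den ≤ S_k + b^{-k}, where S_k = Σ_{i=1}^k d_i b^{-i}.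
-- (Cleared of denominators.)  Together with 0 ≤ d_i < b this is equivalent to
-- num/den = Σ_{i≥1} d_i b^{-i} with the digits not eventually all 0.
IsNonTermExpansion : (b : ℕ) → (d : ℕ → ℕ) → (num den : ℕ) → Set
IsNonTermExpansion b d num den =
  ∀ k → (partialNum b d k * den < b ^ k * num)
      × (b ^ k * num ≤ (partialNum b d k + 1) * den)

module Submission where

-- Let D = ϑ-den p n = n (p - 1) and b = p^n, so ϑ(p^n) = 1/D, and let d be its
-- base-b digits.  Long division produces remainders r_k = b^k - P_k D lying in
-- [1, D] (P_k is the k-th partial numerator), with b r_k = d_{k+1} D + r_{k+1};
-- so r_k determines d_{k+1}, and r_J = r_{J+s} holds iff D ∣ b^J (b^s - 1).
--
-- Arithmetic of D: write n = p^a m with p ∤ m.  Then D = p^a · m(p - 1) where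
-- p^a ∣ b (as a < p^a ≤ n) and m(p - 1) is coprime to b.  Hence D "absorbs
-- powers of b": D ∣ b^j X implies D ∣ b X.
--
-- By pigeonhole two remainders r_J = r_{J+s} (s ≥ 1) coincide; absorption
-- turns D ∣ b^J (b^s - 1) into D ∣ b (b^s - 1), i.e. r_t = r_{t+s} for all
-- t ≥ 1, so d_{i+s} = d_i for all i ≥ 2.  Comparing d_{s+1} with d_1 decides
-- between the purely periodic and the one-non-periodic-digit case.

open import Defs
open import Data.Nat using (ℕ; zero; suc; _+_; _*_; _∸_; _^_; _≤_; _<_; z≤n; s≤s; z<s; NonZero; >-nonZero; nonTrivial⇒n>1)
open import Data.Nat.Properties
open import Data.Nat.Divisibility using (_∣_; divides; _∣?_; ∣-trans; ∣1⇒≡1; ∣⇒≤; *-pres-∣; n∣m*n; ∣n⇒∣m*n)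
open import Data.Nat.Coprimality using (Coprime; coprime-divisor)
open import Data.Nat.Primality using (Prime; euclidsLemma; prime⇒irreducible; prime⇒nonTrivial; ¬prime[0]; ¬prime[1])
open import Data.Nat.Induction using (<-wellFounded)
open import Induction.WellFounded using (Acc; acc)
open import Data.Nat.Tactic.RingSolver using (solve-∀)
open import Data.Fin using (Fin; toℕ; fromℕ<)
open import Data.Fin.Properties using (pigeonhole; toℕ-fromℕ<)
open import Data.Product using (_×_; ∃-syntax; _,_; proj₁; proj₂)
open import Data.Sum using (_⊎_; inj₁; inj₂)
open import Data.Empty using (⊥-elim)
open import Relation.Nullary using (¬_; yes; no)
open import Relation.Binary using (tri<; tri≈; tri>)
open import Relation.Binary.PropositionalEquality

shifted-division-mono : ∀ {D q q' r r'} → r ≤ D → 1 ≤ r' → q < q' →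
  q * D + r < q' * D + r'
shifted-division-mono {D} {q} {q'} {r} {r'} r≤D 1≤r' q<q' = begin-strict
  q * D + r   ≤⟨ +-monoʳ-≤ (q * D) r≤D ⟩
  q * D + D   ≡⟨ +-comm (q * D) D ⟩
  suc q * D   ≤⟨ *-monoˡ-≤ D q<q' ⟩
  q' * D      <⟨ m<m+n (q' * D) 1≤r' ⟩
  q' * D + r' ∎
  where open ≤-Reasoning

shifted-division-unique : ∀ {D q q' r r'} → 1 ≤ r → r ≤ D → 1 ≤ r' → r' ≤ D →
  q * D + r ≡ q' * D + r' → q ≡ q' × r ≡ r'
shifted-division-unique {D} {q} {q'} {r} {r'} 1≤r r≤D 1≤r' r'≤D eq with <-cmp q q'
... | tri< q<q' _ _ = ⊥-elim (<-irrefl eq (shifted-division-mono r≤D 1≤r' q<q'))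
... | tri≈ _ refl _ = refl , +-cancelˡ-≡ (q * D) r r' eq
... | tri> _ _ q'<q = ⊥-elim (<-irrefl (sym eq) (shifted-division-mono r'≤D 1≤r q'<q))

power-gap : ∀ b J s → b ^ J * (b ^ s ∸ 1) ≡ b ^ (J + s) ∸ b ^ J
power-gap b J s = begin
  b ^ J * (b ^ s ∸ 1)       ≡⟨ *-distribˡ-∸ (b ^ J) (b ^ s) 1 ⟩
  b ^ J * b ^ s ∸ b ^ J * 1 ≡⟨ cong₂ _∸_ (sym (^-distribˡ-+-* b J s)) (*-identityʳ (b ^ J)) ⟩
  b ^ (J + s) ∸ b ^ J       ∎
  where open ≡-Reasoning

coprime-*ʳ : ∀ {m x y} → Coprime m x → Coprime m y → Coprime m (x * y)
coprime-*ʳ m⊥x m⊥y (i∣m , i∣xy) =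
  m⊥y (i∣m , coprime-divisor (λ (j∣i , j∣x) → m⊥x (∣-trans j∣i i∣m , j∣x)) i∣xy)

coprime-^ʳ : ∀ {m x} → Coprime m x → ∀ k → Coprime m (x ^ k)
coprime-^ʳ m⊥x zero    (_ , i∣1) = ∣1⇒≡1 i∣1
coprime-^ʳ m⊥x (suc k) = coprime-*ʳ m⊥x (coprime-^ʳ m⊥x k)

coprime-prime : ∀ {p m} → Prime p → ¬ p ∣ m → Coprime m p
coprime-prime pp p∤m (i∣m , i∣p) with prime⇒irreducible pp i∣p
... | inj₁ i≡1 = i≡1
... | inj₂ refl = ⊥-elim (p∤m i∣m)

prime>1 : ∀ {p} → Prime p → 1 < p
prime>1 {p} pp = nonTrivial⇒n>1 p {{prime⇒nonTrivial pp}}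

prime∤pred : ∀ {p} → Prime p → ¬ p ∣ p ∸ 1
prime∤pred {zero}        pp = ⊥-elim (¬prime[0] pp)
prime∤pred {suc zero}    pp = ⊥-elim (¬prime[1] pp)
prime∤pred {suc (suc q)} _  p∣p-1 = n≮n (suc q) (∣⇒≤ p∣p-1)

exponent<power : ∀ {p} → 1 < p → ∀ a → a < p ^ a
exponent<power 1<p zero    = z<s
exponent<power {p} 1<p (suc a) = ≤-<-trans (exponent<power 1<p a) (^-monoʳ-< p 1<p (n<1+n a))

power-divides : ∀ p {a n} → a ≤ n → p ^ a ∣ p ^ n
power-divides p {a} {n} a≤n = divides (p ^ (n ∸ a)) (begin
  p ^ n               ≡⟨ cong (p ^_) (sym (m+[n∸m]≡n a≤n)) ⟩
  p ^ (a + (n ∸ a))   ≡⟨ ^-distribˡ-+-* p a (n ∸ a) ⟩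
  p ^ a * p ^ (n ∸ a) ≡⟨ *-comm (p ^ a) _ ⟩
  p ^ (n ∸ a) * p ^ a ∎)
  where open ≡-Reasoning

p-adic-split : ∀ {p} → 1 < p → ∀ n → 1 ≤ n → ∃[ a ] ∃[ m ] (n ≡ p ^ a * m × ¬ p ∣ m)
p-adic-split {p} 1<p n 1≤n = go n 1≤n (<-wellFounded n)
  where
  go : ∀ n → 1 ≤ n → Acc _<_ n → ∃[ a ] ∃[ m ] (n ≡ p ^ a * m × ¬ p ∣ m)
  go n 1≤n (acc smaller) with p ∣? n
  ... | no p∤n = 0 , n , sym (+-identityʳ n) , p∤n
  ... | yes (divides zero n≡0) = ⊥-elim (<-irrefl (sym n≡0) 1≤n)
  ... | yes (divides (suc q) n≡q*p)
    with go (suc q) z<s (smaller (subst (suc q <_) (sym n≡q*p) (m<m*n (suc q) p 1<p)))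
  ...   | a , m , q≡pᵃm , p∤m = suc a , m , trans n≡q*p (trans (cong (_* p) q≡pᵃm) (reassoc (p ^ a) m p)) , p∤m
    where
    reassoc : ∀ x y z → x * y * z ≡ z * x * y
    reassoc = solve-∀

-- D absorbs the powers of b when D ∣ b^j X already forces D ∣ b X; this is
-- exactly what keeps the pre-period of 1/D in base b at most one digit.
AbsorbsPowers : ℕ → ℕ → Set
AbsorbsPowers b D = ∀ j X → D ∣ b ^ j * X → D ∣ b * X

absorbs-powers : ∀ {b u v} → u ∣ b → Coprime v b → AbsorbsPowers b (u * v)
absorbs-powers {u = u} u∣b v⊥b j X uv∣bʲX =
  *-pres-∣ u∣b (coprime-divisor (coprime-^ʳ v⊥b j) (∣-trans (n∣m*n u) uv∣bʲX))

-- ϑ-den p n = p^a · m(p - 1) with p^a ∣ p^n and m(p - 1) coprime to p^n.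
ϑ-den-absorbs : ∀ {p n} → Prime p → 1 ≤ n → AbsorbsPowers (p ^ n) (ϑ-den p n)
ϑ-den-absorbs {p} {n} pp 1≤n with p-adic-split (prime>1 pp) n 1≤n
... | a , m , n≡pᵃm , p∤m =
  subst (AbsorbsPowers (p ^ n)) (sym D≡) (absorbs-powers (power-divides p a≤n) v⊥pⁿ)
  where
  D≡ : ϑ-den p n ≡ p ^ a * (m * (p ∸ 1))
  D≡ = trans (cong (_* (p ∸ 1)) n≡pᵃm) (*-assoc (p ^ a) m (p ∸ 1))
  a≤n : a ≤ n
  a≤n = <⇒≤ (<-≤-trans (exponent<power (prime>1 pp) a)
          (∣⇒≤ {{>-nonZero 1≤n}} (subst (p ^ a ∣_) (sym n≡pᵃm) (divides m (*-comm (p ^ a) m)))))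
  p∤v : ¬ p ∣ m * (p ∸ 1)
  p∤v p∣v with euclidsLemma m (p ∸ 1) pp p∣v
  ... | inj₁ p∣m   = p∤m p∣m
  ... | inj₂ p∣p-1 = prime∤pred pp p∣p-1
  v⊥pⁿ : Coprime (m * (p ∸ 1)) (p ^ n)
  v⊥pⁿ = coprime-^ʳ (coprime-prime pp p∤v) n

Periodic : ℕ → ℕ → (ℕ → ℕ) → Set
Periodic k s d = ∀ i → k ≤ i → d (i + s) ≡ d i

PurelyOrMixedPeriodic : (ℕ → ℕ) → Set
PurelyOrMixedPeriodic d =
  (∃[ s ] (1 ≤ s × Periodic 1 s d)) ⊎ (∃[ s ] (1 ≤ s × Periodic 2 s d × d (s + 1) ≢ d 1))

periodic-from-2⇒dichotomy : ∀ d s → 1 ≤ s → Periodic 2 s d → PurelyOrMixedPeriodic d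
periodic-from-2⇒dichotomy d s 1≤s per with d (s + 1) ≟ d 1
... | no  first-breaks = inj₂ (s , 1≤s , per , first-breaks)
... | yes first-fits   = inj₁ (s , 1≤s , per₁)
  where
  per₁ : Periodic 1 s d
  per₁ (suc zero)    _ = trans (cong d (+-comm 1 s)) first-fits
  per₁ (suc (suc i)) _ = per (suc (suc i)) (s≤s (s≤s z≤n))

module LongDivision (b D : ℕ) (d : ℕ → ℕ) (expansion : IsNonTermExpansion b d 1 D) where

  P : ℕ → ℕ
  P = partialNum b d

  remainder : ℕ → ℕ
  remainder k = b ^ k ∸ P k * D

  below : ∀ k → P k * D < b ^ k
  below k = subst (P k * D <_) (*-identityʳ (b ^ k)) (proj₁ (expansion k))

  above : ∀ k → b ^ k ≤ P k * D + D
  above k = subst₂ _≤_ (*-identityʳ (b ^ k)) (trans (*-distribʳ-+ D (P k) 1) (cong (P k * D +_) (+-identityʳ D)))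
              (proj₂ (expansion k))

  division : ∀ k → P k * D + remainder k ≡ b ^ k
  division k = m+[n∸m]≡n (<⇒≤ (below k))

  remainder-positive : ∀ k → 1 ≤ remainder k
  remainder-positive k = m<n⇒0<n∸m (below k)

  remainder≤D : ∀ k → remainder k ≤ D
  remainder≤D k = ≤-trans (∸-monoˡ-≤ (P k * D) (above k)) (≤-reflexive (m+n∸m≡n (P k * D) D))

  division-step : ∀ k → d (suc k) * D + remainder (suc k) ≡ b * remainder k
  division-step k = +-cancelˡ-≡ (P k * b * D) _ _ (begin
    P k * b * D + (d (suc k) * D + remainder (suc k)) ≡⟨ expand-next (P k) b D (d (suc k)) (remainder (suc k)) ⟩
    P (suc k) * D + remainder (suc k)                 ≡⟨ division (suc k) ⟩
    b * b ^ k                                         ≡⟨ cong (b *_) (sym (division k)) ⟩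
    b * (P k * D + remainder k)                       ≡⟨ expand-scaled b (P k) D (remainder k) ⟩
    P k * b * D + b * remainder k                     ∎)
    where
    open ≡-Reasoning
    expand-next : ∀ x y z w t → x * y * z + (w * z + t) ≡ (x * y + w) * z + t
    expand-next = solve-∀
    expand-scaled : ∀ y x z t → y * (x * z + t) ≡ x * y * z + y * t
    expand-scaled = solve-∀

  digit-determined : ∀ k k' → remainder k ≡ remainder k' → d (suc k) ≡ d (suc k')
  digit-determined k k' r≡r' = proj₁ (shifted-division-unique
    (remainder-positive (suc k)) (remainder≤D (suc k)) (remainder-positive (suc k')) (remainder≤D (suc k'))
    (trans (division-step k) (trans (cong (b *_) r≡r') (sym (division-step k')))))

  agree⇒divides : ∀ J s → remainder J ≡ remainder (J + s) → D ∣ b ^ (J + s) ∸ b ^ J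
  agree⇒divides J s rJ≡ = divides (P (J + s) ∸ P J) (begin
    b ^ (J + s) ∸ b ^ J                                  ≡⟨ cong₂ _∸_ (sym (division (J + s))) (sym (division J)) ⟩
    P (J + s) * D + r′ ∸ (P J * D + remainder J)         ≡⟨ cong₂ _∸_ (+-comm (P (J + s) * D) r′) (trans (+-comm (P J * D) _) (cong (_+ P J * D) rJ≡)) ⟩
    r′ + P (J + s) * D ∸ (r′ + P J * D)                  ≡⟨ [m+n]∸[m+o]≡n∸o r′ _ _ ⟩
    P (J + s) * D ∸ P J * D                              ≡⟨ sym (*-distribʳ-∸ D (P (J + s)) (P J)) ⟩
    (P (J + s) ∸ P J) * D                                ∎)
    where
    open ≡-Reasoning
    r′ : ℕ
    r′ = remainder (J + s)

  -- The expansion forces b ≥ 1 (as 0 ≤ P_1 D < b), so powers of b increase.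
  instance
    b-nonZero : NonZero b
    b-nonZero = >-nonZero (≤-<-trans z≤n (subst (P 1 * D <_) (*-identityʳ b) (below 1)))

  divides⇒agree : ∀ J s → D ∣ b ^ (J + s) ∸ b ^ J → remainder J ≡ remainder (J + s)
  divides⇒agree J s (divides c gap≡cD) = proj₂ (shifted-division-unique {q = P J + c} {q' = P (J + s)}
    (remainder-positive J) (remainder≤D J) (remainder-positive (J + s)) (remainder≤D (J + s)) (begin
    (P J + c) * D + remainder J       ≡⟨ regroup (P J) c D (remainder J) ⟩
    (P J * D + remainder J) + c * D   ≡⟨ cong₂ _+_ (division J) (sym gap≡cD) ⟩
    b ^ J + (b ^ (J + s) ∸ b ^ J)     ≡⟨ m+[n∸m]≡n (^-monoʳ-≤ b (m≤m+n J s)) ⟩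
    b ^ (J + s)                       ≡⟨ sym (division (J + s)) ⟩
    P (J + s) * D + remainder (J + s) ∎))
    where
    open ≡-Reasoning
    regroup : ∀ x c z r → (x + c) * z + r ≡ (x * z + r) + c * z
    regroup = solve-∀

  -- Remainders take only D values: r_k ↦ r_k - 1 codes them in Fin D.
  code : Fin (suc D) → Fin D
  code i = fromℕ< (<-≤-trans (∸-monoʳ-< z<s (remainder-positive k)) (remainder≤D k))
    where k = toℕ i

  remainder-repeats : ∃[ J ] ∃[ s ] (1 ≤ s × remainder J ≡ remainder (J + s))
  remainder-repeats with pigeonhole (n<1+n D) code
  ... | i , j , i<j , same-code = toℕ i , toℕ j ∸ toℕ i , m<n⇒0<n∸m i<j , (begin
    remainder (toℕ i)                   ≡⟨ ∸-cancelʳ-≡ (remainder-positive (toℕ i)) (remainder-positive (toℕ j)) same-pred ⟩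
    remainder (toℕ j)                   ≡⟨ cong remainder (sym (m+[n∸m]≡n (<⇒≤ i<j))) ⟩
    remainder (toℕ i + (toℕ j ∸ toℕ i)) ∎)
    where
    open ≡-Reasoning
    same-pred : remainder (toℕ i) ∸ 1 ≡ remainder (toℕ j) ∸ 1
    same-pred = trans (sym (toℕ-fromℕ< _)) (trans (cong toℕ same-code) (toℕ-fromℕ< _))

  periodic-from-2 : ∀ s → D ∣ b * (b ^ s ∸ 1) → Periodic 2 s d
  periodic-from-2 s _ (suc zero) (s≤s ())
  periodic-from-2 s D∣b[bˢ-1] (suc (suc t)) _ =
    sym (digit-determined (suc t) (suc t + s) (divides⇒agree (suc t) s D∣gap))
    where
    D∣gap : D ∣ b ^ (suc t + s) ∸ b ^ suc t
    D∣gap = subst (D ∣_) (trans (reassoc b (b ^ t) (b ^ s ∸ 1)) (power-gap b (suc t) s))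
                  (∣n⇒∣m*n (b ^ t) D∣b[bˢ-1])
      where
      reassoc : ∀ x y z → y * (x * z) ≡ x * y * z
      reassoc = solve-∀

  dichotomy : AbsorbsPowers b D → PurelyOrMixedPeriodic d
  dichotomy absorbs with remainder-repeats
  ... | J , s , 1≤s , rJ≡ = periodic-from-2⇒dichotomy d s 1≤s (periodic-from-2 s D∣b[bˢ-1])
    where
    D∣b[bˢ-1] : D ∣ b * (b ^ s ∸ 1)
    D∣b[bˢ-1] = absorbs J (b ^ s ∸ 1) (subst (D ∣_) (sym (power-gap b J s)) (agree⇒divides J s rJ≡))

corollary2 : (p n : ℕ) → Prime p → 1 ≤ n →
    (d : ℕ → ℕ) → (∀ i → 1 ≤ i → d i < p ^ n) →
    IsNonTermExpansion (p ^ n) d 1 (ϑ-den p n) →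
    (∃[ s ] (1 ≤ s × (∀ i → 1 ≤ i → d (i + s) ≡ d i)))
    ⊎ (∃[ s ] (1 ≤ s × (∀ i → 2 ≤ i → d (i + s) ≡ d i) × d (s + 1) ≢ d 1))
corollary2 p n pp 1≤n d _ expansion =
  LongDivision.dichotomy (p ^ n) (ϑ-den p n) d expansion (ϑ-den-absorbs pp 1≤n)
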